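{- Let $\mathbb{V}$ be a vector space of dimension $n$ over the field with $2$ elements, with basis $\{b_1,\dots,b_n\}$, and let $G(\mathbb{V})$ be its non-zero component graph. Let $b_l,b_m$ be two distinct basis vectors. Then for each $i$ with $1\le i\le n-1$ there exist $\binom{n-1}{i-1}-\binom{n-2}{i-2}$ pairs of distinct vertices $u,v\in T_i$ such that $b_l\in S_u\setminus S_v$ and $b_m\in S_v\setminus S_u$.
   Context: The non-zero component graph $G(\mathbb{V})$ of a finite-dimensional vector space $\mathbb{V}$ with a fixed basis $\{b_1,\dots,b_n\}$ has as vertex set the non-zero vectors of $\mathbb{V}$, two distinct vertices being adjacent if and only if there is some $b_i$ having non-zero coefficient in the expansions of both vectors with respect to the basis. The skeleton $S_u$ of a vertex $u$ is the set of basis vectors having non-zero coefficient in the expansion of $u$. For $1\le i\le n$, $T_i=\{v\in V(G(\mathbb{V})): |S_v|=i\}$. The convention $\binom{a}{b}=0$ for $b<0$ is used. -}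

module Defs where

open import Data.Bool using (Bool; true; false)
open import Data.Nat using (ℕ; zero; suc)
open import Data.Nat.Combinatorics using (_C_)
open import Data.Integer using (ℤ; +_; -[1+_])
open import Data.Fin using (Fin)
open import Data.Vec using (Vec; lookup; replicate; countᵇ)
open import Data.Product using (_×_)
open import Relation.Binary.PropositionalEquality using (_≡_; _≢_)
open import Relation.Nullary using (¬_)
open import Function using (id)

-- The n-dimensional vector space over the field with 2 elements (Bool),
-- represented by coordinate vectors with respect to the fixed basis b_1..b_n
-- (index j : Fin n stands for basis vector b_(j+1)).
Vect : ℕ → Set
Vect n = Vec Bool n

zeroVec : (n : ℕ) → Vect n
zeroVec n = replicate n false

IsVertex : {n : ℕ} → Vect n → Set
IsVertex {n} u = u ≢ zeroVec n

_∈S_ : {n : ℕ} → Fin n → Vect n → Set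
j ∈S u = lookup u j ≡ true

skelSize : {n : ℕ} → Vect n → ℕ
skelSize u = countᵇ id u

InT : {n : ℕ} → ℕ → Vect n → Set
InT i u = IsVertex u × skelSize u ≡ i

-- Binomial coefficient with integer lower index, 0 for negative lower index.
binom : ℕ → ℤ → ℕ
binom a (+ k) = a C k
binom a -[1+ k ] = 0

-- The pairs are (W ∪ {b_l}, W ∪ {b_m}) for the (i-1)-subsets W of the basis avoiding b_l and b_m.
-- There are C(n-2, i-1) such W, and Pascal's rule turns this into C(n-1, i-1) - C(n-2, i-2).
module Submission where

open import Defs
open import Data.Nat using (ℕ; _≤_; _∸_)
open import Data.Integer using (ℤ; +_; _-_)
open import Data.Fin using (Fin)
open import Data.Product using (Σ; ∃; _×_; proj₁; proj₂)
open import Function.Definitions using (Injective)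
open import Relation.Binary.PropositionalEquality using (_≡_; _≢_)
open import Relation.Nullary using (¬_)

open import Data.Bool using (Bool; true; false; not)
open import Data.Nat using (zero; suc; _+_)
open import Data.Nat.Combinatorics using (_C_; nCk+nC[k+1]≡[n+1]C[k+1])
open import Data.Nat.Properties using (suc-injective; m≤m+n; m+n∸m≡n)
open import Data.Integer using (_⊖_)
open import Data.Integer.Properties using (m-n≡m⊖n; ⊖-≥)
open import Data.Fin using (zero; suc)
open import Data.Vec using (Vec; []; _∷_; lookup; replicate; countᵇ; _[_]≔_)
open import Data.Vec.Properties
  using (lookup∘update; lookup∘update′; []≔-lookup; []≔-idempotent; lookup-replicate)
open import Data.List as List using (List; map; _++_; length)
open import Data.List.Properties using (length-map; length-++)
open import Data.List.Relation.Unary.All as All using (All)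
import Data.List.Relation.Unary.All.Properties as All
open import Data.List.Relation.Unary.AllPairs using (AllPairs)
open import Data.List.Relation.Unary.Unique.Propositional using (Unique)
import Data.List.Relation.Unary.Unique.Propositional.Properties as Unique
open import Data.List.Membership.Propositional using (_∈_)
open import Data.List.Membership.Propositional.Properties using (∈-lookup; ∈-map⁻)
open import Data.Product using (_,_)
open import Data.Empty using (⊥-elim)
open import Relation.Binary.PropositionalEquality using (refl; sym; trans; cong; cong₂; subst; module ≡-Reasoning)
open import Function using (_∘_)
open ≡-Reasoning

private variable k : ℕ

Avoids : Vec Bool k → Vec Bool k → Set
Avoids mask w = ∀ p → p ∈S mask → lookup w p ≡ false

freeCount : Vec Bool k → ℕ
freeCount = countᵇ not

avoidingOfWeight : Vec Bool k → ℕ → List (Vec Bool k)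
avoidingOfWeight []             zero    = List.[ [] ]
avoidingOfWeight []             (suc j) = List.[]
avoidingOfWeight (true ∷ mask)  j       = map (false ∷_) (avoidingOfWeight mask j)
avoidingOfWeight (false ∷ mask) zero    = map (false ∷_) (avoidingOfWeight mask zero)
avoidingOfWeight (false ∷ mask) (suc j) =
  map (true ∷_) (avoidingOfWeight mask j) ++ map (false ∷_) (avoidingOfWeight mask (suc j))

length-avoidingOfWeight : (mask : Vec Bool k) (j : ℕ) →
                          length (avoidingOfWeight mask j) ≡ freeCount mask C j
length-avoidingOfWeight []             zero    = refl
length-avoidingOfWeight []             (suc j) = refl
length-avoidingOfWeight (true ∷ mask)  j       =
  trans (length-map _ (avoidingOfWeight mask j)) (length-avoidingOfWeight mask j)
length-avoidingOfWeight (false ∷ mask) zero    =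
  trans (length-map _ (avoidingOfWeight mask zero)) (length-avoidingOfWeight mask zero)
length-avoidingOfWeight (false ∷ mask) (suc j) = begin
  length (map (true ∷_) ws ++ map (false ∷_) ws′)  ≡⟨ length-++ (map (true ∷_) ws) ⟩
  length (map (true ∷_) ws) + length (map (false ∷_) ws′)
    ≡⟨ cong₂ _+_ (length-map _ ws) (length-map _ ws′) ⟩
  length ws + length ws′
    ≡⟨ cong₂ _+_ (length-avoidingOfWeight mask j) (length-avoidingOfWeight mask (suc j)) ⟩
  freeCount mask C j + freeCount mask C suc j      ≡⟨ nCk+nC[k+1]≡[n+1]C[k+1] (freeCount mask) j ⟩
  suc (freeCount mask) C suc j                     ∎
  where
  ws  = avoidingOfWeight mask j
  ws′ = avoidingOfWeight mask (suc j)

∷-injectiveʳ : {b : Bool} {v w : Vec Bool k} → b ∷ v ≡ b ∷ w → v ≡ w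
∷-injectiveʳ refl = refl

avoidingOfWeight-unique : (mask : Vec Bool k) (j : ℕ) → Unique (avoidingOfWeight mask j)
avoidingOfWeight-unique []             zero    = All.[] AllPairs.∷ AllPairs.[]
avoidingOfWeight-unique []             (suc j) = AllPairs.[]
avoidingOfWeight-unique (true ∷ mask)  j       =
  Unique.map⁺ ∷-injectiveʳ (avoidingOfWeight-unique mask j)
avoidingOfWeight-unique (false ∷ mask) zero    =
  Unique.map⁺ ∷-injectiveʳ (avoidingOfWeight-unique mask zero)
avoidingOfWeight-unique (false ∷ mask) (suc j) =
  Unique.++⁺ (Unique.map⁺ ∷-injectiveʳ (avoidingOfWeight-unique mask j))
             (Unique.map⁺ ∷-injectiveʳ (avoidingOfWeight-unique mask (suc j)))
             heads-differ
  where
  heads-differ : ∀ {v} → ¬ (v ∈ map (true ∷_) _ × v ∈ map (false ∷_) _)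
  heads-differ (v∈ , v∈′) with ∈-map⁻ (true ∷_) v∈ | ∈-map⁻ (false ∷_) v∈′
  ... | _ , _ , refl | _ , _ , ()

avoidingOfWeight-weight : (mask : Vec Bool k) (j : ℕ) →
                          All (λ w → skelSize w ≡ j) (avoidingOfWeight mask j)
avoidingOfWeight-weight []             zero    = refl All.∷ All.[]
avoidingOfWeight-weight []             (suc j) = All.[]
avoidingOfWeight-weight (true ∷ mask)  j       = All.map⁺ (avoidingOfWeight-weight mask j)
avoidingOfWeight-weight (false ∷ mask) zero    = All.map⁺ (avoidingOfWeight-weight mask zero)
avoidingOfWeight-weight (false ∷ mask) (suc j) =
  All.++⁺ (All.map⁺ (All.map (cong suc) (avoidingOfWeight-weight mask j)))
          (All.map⁺ (avoidingOfWeight-weight mask (suc j)))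

∷-avoids : ∀ {b c} {mask w : Vec Bool k} → (b ≡ true → c ≡ false) →
           Avoids mask w → Avoids (b ∷ mask) (c ∷ w)
∷-avoids b⇒¬c mask∩w zero    = b⇒¬c
∷-avoids b⇒¬c mask∩w (suc p) = mask∩w p

avoidingOfWeight-avoids : (mask : Vec Bool k) (j : ℕ) → All (Avoids mask) (avoidingOfWeight mask j)
avoidingOfWeight-avoids []             zero    = (λ ()) All.∷ All.[]
avoidingOfWeight-avoids []             (suc j) = All.[]
avoidingOfWeight-avoids (true ∷ mask)  j       =
  All.map⁺ (All.map (∷-avoids λ _ → refl) (avoidingOfWeight-avoids mask j))
avoidingOfWeight-avoids (false ∷ mask) zero    =
  All.map⁺ (All.map (∷-avoids λ ()) (avoidingOfWeight-avoids mask zero))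
avoidingOfWeight-avoids (false ∷ mask) (suc j) =
  All.++⁺ (All.map⁺ (All.map (∷-avoids λ ()) (avoidingOfWeight-avoids mask j)))
          (All.map⁺ (All.map (∷-avoids λ ()) (avoidingOfWeight-avoids mask (suc j))))

Unique⇒lookup-injective : {A : Set} {xs : List A} → Unique xs → Injective _≡_ _≡_ (List.lookup xs)
Unique⇒lookup-injective (x∉ AllPairs.∷ _) {zero}  {zero}  _  = refl
Unique⇒lookup-injective (x∉ AllPairs.∷ _) {zero}  {suc j} eq = ⊥-elim (All.lookup x∉ (∈-lookup j) eq)
Unique⇒lookup-injective (x∉ AllPairs.∷ _) {suc i} {zero}  eq = ⊥-elim (All.lookup x∉ (∈-lookup i) (sym eq))
Unique⇒lookup-injective (_ AllPairs.∷ xs!) {suc i} {suc j} eq =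
  cong suc (Unique⇒lookup-injective xs! eq)

countᵇ-[]≔ : {A : Set} (P : A → Bool) (w : Vec A k) (p : Fin k) {b : A} →
             P (lookup w p) ≡ false → P b ≡ true → countᵇ P (w [ p ]≔ b) ≡ suc (countᵇ P w)
countᵇ-[]≔ P (x ∷ w) zero    Px≡false Pb≡true rewrite Px≡false | Pb≡true = refl
countᵇ-[]≔ P (x ∷ w) (suc p) Px≡false Pb≡true with P x
... | true  = cong suc (countᵇ-[]≔ P w p Px≡false Pb≡true)
... | false = countᵇ-[]≔ P w p Px≡false Pb≡true

[]≔-restore : {A : Set} (w : Vec A k) (p : Fin k) {x y : A} →
              lookup w p ≡ x → (w [ p ]≔ y) [ p ]≔ x ≡ w
[]≔-restore w p refl = trans ([]≔-idempotent w p) ([]≔-lookup w p)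

[]≔true-injective : (p : Fin k) {v w : Vec Bool k} → lookup v p ≡ false → lookup w p ≡ false →
                    v [ p ]≔ true ≡ w [ p ]≔ true → v ≡ w
[]≔true-injective p {v} {w} v[p]≡false w[p]≡false eq = begin
  v                           ≡⟨ []≔-restore v p v[p]≡false ⟨
  (v [ p ]≔ true) [ p ]≔ false ≡⟨ cong (_[ p ]≔ false) eq ⟩
  (w [ p ]≔ true) [ p ]≔ false ≡⟨ []≔-restore w p w[p]≡false ⟩
  w                           ∎

skelSize-[]≔true : (w : Vec Bool k) (p : Fin k) → lookup w p ≡ false →
                   skelSize (w [ p ]≔ true) ≡ suc (skelSize w)
skelSize-[]≔true w p w[p]≡false = countᵇ-[]≔ (λ b → b) w p w[p]≡false refl

freeCount-[]≔true : (w : Vec Bool k) (p : Fin k) → lookup w p ≡ false →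
                    suc (freeCount (w [ p ]≔ true)) ≡ freeCount w
freeCount-[]≔true w p w[p]≡false = begin
  suc (freeCount (w [ p ]≔ true))                ≡⟨ countᵇ-[]≔ not (w [ p ]≔ true) p (cong not (lookup∘update p w true)) refl ⟨
  freeCount ((w [ p ]≔ true) [ p ]≔ false)       ≡⟨ cong freeCount ([]≔-restore w p w[p]≡false) ⟩
  freeCount w                                    ∎

freeCount-replicate : ∀ k → freeCount (replicate k false) ≡ k
freeCount-replicate zero    = refl
freeCount-replicate (suc k) = cong suc (freeCount-replicate k)

∉S-false : {p : Fin k} (v : Vec Bool k) → lookup v p ≡ false → ¬ (p ∈S v)
∉S-false v v[p]≡false p∈v with trans (sym v[p]≡false) p∈v
... | ()

∈S⇒IsVertex : {p : Fin k} {v : Vec Bool k} → p ∈S v → IsVertex v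
∈S⇒IsVertex {k} {p} p∈v refl = ∉S-false (replicate k false) (lookup-replicate p false) p∈v

pairMask : Fin k → Fin k → Vec Bool k
pairMask l m = (replicate _ false [ l ]≔ true) [ m ]≔ true

module _ {l m : Fin k} (l≢m : l ≢ m) where

  private
    singleton : Vec Bool k
    singleton = replicate k false [ l ]≔ true

    lookup-singleton-m : lookup singleton m ≡ false
    lookup-singleton-m = trans (lookup∘update′ (λ m≡l → l≢m (sym m≡l)) (replicate k false) true) (lookup-replicate m false)

  l∈S-pairMask : l ∈S pairMask l m
  l∈S-pairMask = trans (lookup∘update′ l≢m singleton true) (lookup∘update l (replicate k false) true)

  m∈S-pairMask : m ∈S pairMask l m
  m∈S-pairMask = lookup∘update m singleton true

  freeCount-pairMask : suc (suc (freeCount (pairMask l m))) ≡ k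
  freeCount-pairMask = begin
    suc (suc (freeCount (pairMask l m)))          ≡⟨ cong suc (freeCount-[]≔true singleton m lookup-singleton-m) ⟩
    suc (freeCount singleton)                     ≡⟨ freeCount-[]≔true (replicate k false) l (lookup-replicate l false) ⟩
    freeCount (replicate k false)                 ≡⟨ freeCount-replicate k ⟩
    k                                             ∎

SeparatingPair : ℕ → Fin k → Fin k → Vect k × Vect k → Set
SeparatingPair i l m uv =
  proj₁ uv ≢ proj₂ uv
  × InT i (proj₁ uv) × InT i (proj₂ uv)
  × (l ∈S proj₁ uv) × ¬ (l ∈S proj₂ uv)
  × (m ∈S proj₂ uv) × ¬ (m ∈S proj₁ uv)

addEach : Fin k → Fin k → Vec Bool k → Vect k × Vect k
addEach l m w = w [ l ]≔ true , w [ m ]≔ true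

addEach-separating : {l m : Fin k} {j : ℕ} (w : Vec Bool k) → l ≢ m →
                     lookup w l ≡ false → lookup w m ≡ false → skelSize w ≡ j →
                     SeparatingPair (suc j) l m (addEach l m w)
addEach-separating {l = l} {m} w l≢m w[l]≡false w[m]≡false |w|≡j =
  (λ u≡v → l∉v (subst (l ∈S_) u≡v l∈u)) ,
  (∈S⇒IsVertex l∈u , trans (skelSize-[]≔true w l w[l]≡false) (cong suc |w|≡j)) ,
  (∈S⇒IsVertex m∈v , trans (skelSize-[]≔true w m w[m]≡false) (cong suc |w|≡j)) ,
  l∈u , l∉v , m∈v , m∉u
  where
  l∈u : l ∈S (w [ l ]≔ true)
  l∈u = lookup∘update l w true
  m∈v : m ∈S (w [ m ]≔ true)
  m∈v = lookup∘update m w true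
  l∉v : ¬ (l ∈S (w [ m ]≔ true))
  l∉v = ∉S-false (w [ m ]≔ true) (trans (lookup∘update′ l≢m w true) w[l]≡false)
  m∉u : ¬ (m ∈S (w [ l ]≔ true))
  m∉u = ∉S-false (w [ l ]≔ true) (trans (lookup∘update′ (λ m≡l → l≢m (sym m≡l)) w true) w[m]≡false)

pascal-binom : ∀ n k → + (n C k) ≡ + binom (suc n) (+ suc k - + 1) - + binom n (+ suc k - + 2)
pascal-binom n zero    = refl
pascal-binom n (suc k) = sym (begin
  + (suc n C suc k) - + (n C k)        ≡⟨ cong (λ c → + c - + (n C k)) (nCk+nC[k+1]≡[n+1]C[k+1] n k) ⟨
  + (n C k + n C suc k) - + (n C k)    ≡⟨ m-n≡m⊖n (n C k + n C suc k) (n C k) ⟩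
  (n C k + n C suc k) ⊖ (n C k)        ≡⟨ ⊖-≥ (m≤m+n (n C k) (n C suc k)) ⟩
  + (n C k + n C suc k ∸ n C k)        ≡⟨ cong +_ (m+n∸m≡n (n C k) (n C suc k)) ⟩
  + (n C suc k)                        ∎)

mainTheorem1 : (n : ℕ) (l m : Fin n) → l ≢ m → (i : ℕ) → 1 ≤ i → i ≤ n ∸ 1 →
    Σ ℕ λ N →
      ((+ N) ≡ (+ binom (n ∸ 1) ((+ i) - (+ 1))) - (+ binom (n ∸ 2) ((+ i) - (+ 2))))
      × Σ (Fin N → Vect n × Vect n) λ f →
          Injective _≡_ _≡_ f
          × ((k : Fin N) →
              proj₁ (f k) ≢ proj₂ (f k)
              × InT i (proj₁ (f k)) × InT i (proj₂ (f k))
              × (l ∈S proj₁ (f k)) × ¬ (l ∈S proj₂ (f k))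
              × (m ∈S proj₂ (f k)) × ¬ (m ∈S proj₁ (f k)))
mainTheorem1 (suc zero)    zero zero l≢m _       _ _ = ⊥-elim (l≢m refl)
mainTheorem1 (suc (suc n)) l    m    l≢m (suc i) _ _ =
  length ws , count , addEach l m ∘ List.lookup ws , injective , separating
  where
  ws = avoidingOfWeight (pairMask l m) i

  count : + length ws ≡ + binom (suc n) (+ suc i - + 1) - + binom n (+ suc i - + 2)
  count = trans (cong +_ (trans (length-avoidingOfWeight (pairMask l m) i)
                                (cong (_C i) (suc-injective (suc-injective (freeCount-pairMask l≢m))))))
                (pascal-binom n i)

  avoids : ∀ k → Avoids (pairMask l m) (List.lookup ws k)
  avoids k = All.lookup (avoidingOfWeight-avoids (pairMask l m) i) (∈-lookup k)

  injective : Injective _≡_ _≡_ (addEach l m ∘ List.lookup ws)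
  injective {a} {b} eq = Unique⇒lookup-injective (avoidingOfWeight-unique (pairMask l m) i)
    ([]≔true-injective l (avoids a l (l∈S-pairMask l≢m)) (avoids b l (l∈S-pairMask l≢m)) (cong proj₁ eq))

  separating : ∀ k → SeparatingPair (suc i) l m (addEach l m (List.lookup ws k))
  separating k = addEach-separating (List.lookup ws k) l≢m
    (avoids k l (l∈S-pairMask l≢m)) (avoids k m (m∈S-pairMask l≢m))
    (All.lookup (avoidingOfWeight-weight (pairMask l m) i) (∈-lookup k))
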